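{- Let $r\ge 4$ and $n\in\mathbb{N}$ with $(r-2)\mid n$. Let $I$ be a subgraph of $K_{r,2,n}$ with $\ell$ edges and $c$ components. Then \[|V(I)|\ge\frac{2}{r+1}\ell.\]
   Context: For $r\ge 3$ and $(r-2)\mid n$, $K_{r,2,n}$ is the graph on $\mathbb{Z}_n=\{0,\dots,n-1\}$ whose edge set is the union of the edge sets of the $n/(r-2)$ cliques $K_r$ on the vertex sets $\{i(r-2),\dots,i(r-2)+r-1\}$ (mod $n$), $i\in\{0,\dots,n/(r-2)-1\}$. A subgraph $I$ is identified with its edge set; $V(I)$ is the set of vertices incident to edges of $I$. -}

module Defs where

open import Data.Nat using (ℕ; _+_; _*_; _∸_; _<_)
open import Data.Fin using (Fin; toℕ)
open import Data.Fin.Subset using (Subset; ⊥; _∪_; ⁅_⁆)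
open import Data.List using (List; []; _∷_)
open import Data.Product using (_×_; ∃; ∃-syntax; proj₁; proj₂; _,_)
open import Relation.Binary.PropositionalEquality using (_≡_)

_≡[mod_]_ : ℕ → (n : ℕ) → Fin n → Set
a ≡[mod n ] x = ∃[ t ] (a ≡ toℕ x + t * n)

InClique : (r n i : ℕ) → Fin n → Set
InClique r n i x = ∃[ j ] (j < r × (i * (r ∸ 2) + j) ≡[mod n ] x)

-- u v adjacent in K_{r,2,n}: distinct and in a common clique K_r,
-- i ranging over 0 ≤ i < n/(r-2)  (written i*(r-2) < n)
Adj : (r n : ℕ) → Fin n → Fin n → Set
Adj r n u v = ∃[ i ] (i * (r ∸ 2) < n × InClique r n i u × InClique r n i v)

-- an edge {u,v} of K_{r,2,n}, stored canonically as (u , v) with u < v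
Edge : ℕ → Set
Edge n = Fin n × Fin n

IsEdgeOfK : (r n : ℕ) → Edge n → Set
IsEdgeOfK r n (u , v) = toℕ u < toℕ v × Adj r n u v

V : {n : ℕ} → List (Edge n) → Subset n
V [] = ⊥
V ((u , v) ∷ es) = (⁅ u ⁆ ∪ ⁅ v ⁆) ∪ V es

-- Discharging. Every edge of I carries charge 2, split between its endpoints by a rule with
-- charge x y + charge y x ≥ 2, so 2|I| is at most the charge received by the vertices of V(I)
-- and it suffices that no vertex receives more than r + 1.
-- Write m = r - 2 and cut ℤ_n into blocks of m consecutive vertices: the i-th clique is the
-- i-th block followed by the first two vertices of the next one. A vertex at offset ≥ 2 in its
-- block is interior (it lies in one clique), the others are shared (they lie in two). An edge
-- from an interior vertex to one of the two shared vertices closing its clique is charged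
-- entirely to the interior vertex; every other edge is split 1 + 1.
-- To bound what x receives, put each neighbour of x in its slot of the window of 2m + 2
-- consecutive vertices starting one block before x's block. A slot determines the vertex, and the
-- charge of the edge to the neighbour in slot e is bounded by a weight depending only on e and on
-- whether x is interior; the weights add up to r + 2 over the window, x's own slot taking 1.

module Submission where

open import Defs
open import Data.Nat
  using (ℕ; zero; suc; _+_; _*_; _∸_; _≤_; _<_; _⊓_; z≤n; s≤s; s≤s⁻¹; _≤?_; _<?_; NonZero)
import Data.Nat as ℕ
open import Data.Nat.Properties hiding (_≟_)
open import Data.Nat.DivMod using (_/_; _%_; m≡m%n+[m/n]*n; m%n<n; [m+kn]%n≡m%n; m<n⇒m%n≡m; m≤n⇒[n∸m]%m≡n%m)
open import Data.Nat.Divisibility using (_∣_; divides; ∣-refl)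
open import Data.Nat.ListAction using (sum)
open import Data.Nat.Tactic.RingSolver using (solve-∀)
open import Data.Fin using (Fin; zero; suc; toℕ)
open import Data.Fin.Properties using (_≟_; toℕ<n; toℕ-injective)
open import Data.Fin.Subset using (Subset; ∣_∣; inside; outside) renaming (_∉_ to _∉ₛ_)
open import Data.Fin.Subset.Properties using (x∈p∪q⁺; x∈⁅x⁆; drop-there)
open import Data.Vec using ([]; _∷_)
open import Data.List using (List; []; _∷_; length; map; downFrom)
open import Data.List.Membership.Propositional using (_∈_)
open import Data.List.Membership.Propositional.Properties using (∈-downFrom⁺)
open import Data.List.Relation.Unary.Any using (here; there)
open import Data.List.Relation.Unary.All as All using (All)
open import Data.List.Relation.Unary.AllPairs using (_∷_)
open import Data.List.Relation.Unary.Unique.Propositional using (Unique)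
open import Data.Product using (_×_; ∃; ∃₂; ∃-syntax; proj₁; _,_)
open import Data.Sum using (_⊎_; inj₁; inj₂)
open import Data.Bool using (if_then_else_)
open import Function using (_∘_)
open import Relation.Nullary using (¬_; Dec; yes; no; does; contradiction)
open import Relation.Nullary.Decidable using (dec-true; dec-false; map′; _×-dec_)
open import Relation.Binary using (IsEquivalence; Setoid)
import Relation.Binary.Reasoning.Setoid
open import Relation.Binary.PropositionalEquality
open import Algebra.Properties.CommutativeSemigroup +-commutativeSemigroup
  using (interchange; x∙yz≈y∙xz; xy∙z≈xz∙y)
open import Algebra.Properties.CommutativeMonoid.Sum +-0-commutativeMonoid
  using (sum-syntax; ∑-distrib-+; sum-replicate-zero)

𝟙[_] : {P : Set} → Dec P → ℕ
𝟙[ d ] = if does d then 1 else 0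

𝟙-yes : {P : Set} (d : Dec P) → P → 𝟙[ d ] ≡ 1
𝟙-yes d p rewrite dec-true d p = refl

𝟙-no : {P : Set} (d : Dec P) → ¬ P → 𝟙[ d ] ≡ 0
𝟙-no d ¬p rewrite dec-false d ¬p = refl

1≤𝟙+ : {P : Set} (d : Dec P) → P → ∀ k → 1 ≤ 𝟙[ d ] + k
1≤𝟙+ d p k rewrite 𝟙-yes d p = s≤s z≤n

sum-map-+ : {A : Set} (f g : A → ℕ) (xs : List A) →
  sum (map (λ x → f x + g x) xs) ≡ sum (map f xs) + sum (map g xs)
sum-map-+ f g [] = refl
sum-map-+ f g (x ∷ xs) =
  trans (cong (f x + g x +_) (sum-map-+ f g xs)) (interchange (f x) (g x) _ _)

sum-𝟙-≤ : ∀ a K → sum (map (λ e → 𝟙[ a ≤? e ]) (downFrom K)) ≡ K ∸ a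
sum-𝟙-≤ a zero = sym (0∸n≡0 a)
sum-𝟙-≤ a (suc K) with a ≤? K
... | yes a≤K = trans (cong₂ _+_ (𝟙-yes (a ≤? K) a≤K) (sum-𝟙-≤ a K)) (sym (+-∸-assoc 1 a≤K))
... | no a≰K = trans (cong₂ _+_ (𝟙-no (a ≤? K) a≰K) (sum-𝟙-≤ a K))
                    (trans (m≤n⇒m∸n≡0 (<⇒≤ K<a)) (sym (m≤n⇒m∸n≡0 K<a)))
  where
  K<a : K < a
  K<a = ≰⇒> a≰K

sum-𝟙-< : ∀ b K → sum (map (λ e → 𝟙[ e <? b ]) (downFrom K)) ≡ b ⊓ K
sum-𝟙-< b zero = sym (m≥n⇒m⊓n≡n z≤n)
sum-𝟙-< b (suc K) with K <? b
... | yes K<b = trans (cong₂ _+_ (𝟙-yes (K <? b) K<b) (trans (sum-𝟙-< b K) (m≥n⇒m⊓n≡n (<⇒≤ K<b))))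
                     (sym (m≥n⇒m⊓n≡n K<b))
... | no K≮b = trans (cong₂ _+_ (𝟙-no (K <? b) K≮b) (sum-𝟙-< b K))
                    (trans (m≤n⇒m⊓n≡m b≤K) (sym (m≤n⇒m⊓n≡m (m≤n⇒m≤1+n b≤K))))
  where
  b≤K : b ≤ K
  b≤K = ≮⇒≥ K≮b

sum-extract : {B : Set} (g : B → ℕ) {b : B} {L : List B} → b ∈ L →
  ∃[ L′ ] (sum (map g L) ≡ g b + sum (map g L′) × (∀ {b′} → b′ ∈ L → b′ ≢ b → b′ ∈ L′))
sum-extract g {L = _ ∷ L} (here refl) =
  L , refl , λ { (here refl) b≢b → contradiction refl b≢b ; (there b′∈L) _ → b′∈L }
sum-extract g {b} {c ∷ _} (there b∈L) with L′ , sum≡ , keep ← sum-extract g b∈L =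
  c ∷ L′ ,
  trans (cong (g c +_) sum≡) (x∙yz≈y∙xz (g c) (g b) _) ,
  λ { (here refl) _ → here refl ; (there b′∈L) b′≢b → there (keep b′∈L b′≢b) }

sum-map-≤-injection : {A B : Set} (f : A → ℕ) (g : B → ℕ) (Code : A → B → Set) {U : List A} {L : List B} →
  Unique U → (∀ {a a′ b} → a ∈ U → a′ ∈ U → Code a b → Code a′ b → a ≡ a′) →
  (∀ {a} → a ∈ U → f a ≡ 0 ⊎ ∃[ b ] (Code a b × f a ≤ g b × b ∈ L)) →
  sum (map f U) ≤ sum (map g L)
sum-map-≤-injection f g Code {[]} _ _ _ = z≤n
sum-map-≤-injection f g Code {a ∷ U} (a∉U ∷ unique) injective bound with bound (here refl)
... | inj₁ fa≡0 rewrite fa≡0 =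
  sum-map-≤-injection f g Code unique (λ p q → injective (there p) (there q)) (bound ∘ there)
... | inj₂ (b , code , fa≤gb , b∈L) with L′ , sum≡ , keep ← sum-extract g b∈L =
  subst (f a + sum (map f U) ≤_) (sym sum≡)
    (+-mono-≤ fa≤gb (sum-map-≤-injection f g Code unique (λ p q → injective (there p) (there q)) bound′))
  where
  bound′ : ∀ {a′} → a′ ∈ U → f a′ ≡ 0 ⊎ ∃[ b′ ] (Code a′ b′ × f a′ ≤ g b′ × b′ ∈ L′)
  bound′ a′∈U with bound (there a′∈U)
  ... | inj₁ fa′≡0 = inj₁ fa′≡0
  ... | inj₂ (b′ , code′ , fa′≤gb′ , b′∈L) = inj₂ (b′ , code′ , fa′≤gb′ , keep b′∈L b′≢b)
    where
    b′≢b : b′ ≢ b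
    b′≢b refl = All.lookup a∉U a′∈U (injective (here refl) (there a′∈U) code code′)

sum-map-≤-injection-avoiding : {A B : Set} (f : A → ℕ) (g : B → ℕ) (Code : A → B → Set)
  {U : List A} {L : List B} {b₀ : B} → b₀ ∈ L →
  Unique U → (∀ {a a′ b} → a ∈ U → a′ ∈ U → Code a b → Code a′ b → a ≡ a′) →
  (∀ {a} → a ∈ U → f a ≡ 0 ⊎ ∃[ b ] (Code a b × f a ≤ g b × b ∈ L × b ≢ b₀)) →
  g b₀ + sum (map f U) ≤ sum (map g L)
sum-map-≤-injection-avoiding f g Code {U} b₀∈L unique injective bound
  with L′ , sum≡ , keep ← sum-extract g b₀∈L =
  subst (_ ≤_) (sym sum≡) (+-monoʳ-≤ _ (sum-map-≤-injection f g Code unique injective bound′))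
  where
  bound′ : ∀ {a} → a ∈ U → f a ≡ 0 ⊎ ∃[ b ] (Code a b × f a ≤ g b × b ∈ L′)
  bound′ a∈U with bound a∈U
  ... | inj₁ fa≡0 = inj₁ fa≡0
  ... | inj₂ (b , code , fa≤gb , b∈L , b≢b₀) = inj₂ (b , code , fa≤gb , keep b∈L b≢b₀)

∑-𝟙-≟ : ∀ {n} (u : Fin n) a → ∑[ x < n ] (𝟙[ x ≟ u ] * a) ≡ a
∑-𝟙-≟ {suc n} zero a = trans (cong₂ _+_ (*-identityˡ a) (sum-replicate-zero n)) (+-identityʳ a)
∑-𝟙-≟ {suc n} (suc u) a = ∑-𝟙-≟ u a

∑≤*∣∣ : ∀ {n} (S : Subset n) (f : Fin n → ℕ) a →
  (∀ x → x ∉ₛ S → f x ≡ 0) → (∀ x → f x ≤ a) → ∑[ x < n ] f x ≤ a * ∣ S ∣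
∑≤*∣∣ [] f a _ _ = z≤n
∑≤*∣∣ (inside ∷ S) f a f-out f≤a = subst (f zero + ∑[ x < _ ] f (suc x) ≤_) (sym (*-suc a ∣ S ∣))
  (+-mono-≤ (f≤a zero)
            (∑≤*∣∣ S (f ∘ suc) a (λ x x∉S → f-out (suc x) (x∉S ∘ drop-there)) (f≤a ∘ suc)))
∑≤*∣∣ (outside ∷ S) f a f-out f≤a rewrite f-out zero (λ ()) =
  ∑≤*∣∣ S (f ∘ suc) a (λ x x∉S → f-out (suc x) (x∉S ∘ drop-there)) (f≤a ∘ suc)

module Congruence (n : ℕ) where

  infix 4 _≋_

  _≋_ : ℕ → ℕ → Set
  a ≋ b = ∃₂ λ s t → a + s * n ≡ b + t * n

  ≋-trans : ∀ {a b c} → a ≋ b → b ≋ c → a ≋ c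
  ≋-trans {a} {b} {c} (s , t , a≡b) (s′ , t′ , b≡c) = s + s′ , t′ + t , (begin
    a + (s + s′) * n      ≡⟨ cong (a +_) (*-distribʳ-+ n s s′) ⟩
    a + (s * n + s′ * n)  ≡⟨ +-assoc a _ _ ⟨
    a + s * n + s′ * n    ≡⟨ cong (_+ s′ * n) a≡b ⟩
    b + t * n + s′ * n    ≡⟨ xy∙z≈xz∙y b _ _ ⟩
    b + s′ * n + t * n    ≡⟨ cong (_+ t * n) b≡c ⟩
    c + t′ * n + t * n    ≡⟨ +-assoc c _ _ ⟩
    c + (t′ * n + t * n)  ≡⟨ cong (c +_) (*-distribʳ-+ n t′ t) ⟨
    c + (t′ + t) * n      ∎)
    where open ≡-Reasoning

  ≋-isEquivalence : IsEquivalence _≋_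
  ≋-isEquivalence = record
    { refl = 0 , 0 , refl
    ; sym = λ (s , t , a≡b) → t , s , sym a≡b
    ; trans = ≋-trans
    }

  ≋-setoid : Setoid _ _
  ≋-setoid = record { isEquivalence = ≋-isEquivalence }

  open IsEquivalence ≋-isEquivalence public using () renaming (refl to ≋-refl; sym to ≋-sym)

  ≡⇒≋ : ∀ {a b} → a ≡ b → a ≋ b
  ≡⇒≋ refl = ≋-refl

  +n≋ : ∀ a → a + n ≋ a
  +n≋ a = 0 , 1 , trans (+-identityʳ _) (cong (a +_) (sym (+-identityʳ n)))

  ≋-+ʳ : ∀ {a b} c → a ≋ b → a + c ≋ b + c
  ≋-+ʳ {a} {b} c (s , t , a≡b) = s , t ,
    trans (xy∙z≈xz∙y a c _) (trans (cong (_+ c) a≡b) (xy∙z≈xz∙y b _ c))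

  ≋-cancelʳ : ∀ {a b} c → a + c ≋ b + c → a ≋ b
  ≋-cancelʳ {a} {b} c (s , t , eq) = s , t ,
    +-cancelʳ-≡ c _ _ (trans (xy∙z≈xz∙y a (s * n) c) (trans eq (xy∙z≈xz∙y b c (t * n))))

  ≋⇒%≡ : ∀ {d} .{{_ : NonZero d}} → d ∣ n → ∀ {a b} → a ≋ b → a % d ≡ b % d
  ≋⇒%≡ {d} (divides q n≡qd) {a} {b} (s , t , eq) =
    trans (sym (+*n%≡ a s)) (trans (cong (_% d) eq) (+*n%≡ b t))
    where
    +*n%≡ : ∀ a s → (a + s * n) % d ≡ a % d
    +*n%≡ a s = begin
      (a + s * n) % d        ≡⟨ cong (λ k → (a + s * k) % d) n≡qd ⟩
      (a + s * (q * d)) % d  ≡⟨ cong (λ k → (a + k) % d) (*-assoc s q d) ⟨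
      (a + s * q * d) % d    ≡⟨ [m+kn]%n≡m%n a (s * q) d ⟩
      a % d                  ∎
      where open ≡-Reasoning

  ≋⇒≡ : .{{_ : NonZero n}} → ∀ {a b} → a < n → b < n → a ≋ b → a ≡ b
  ≋⇒≡ {a} {b} a<n b<n a≋b =
    trans (sym (m<n⇒m%n≡m a<n)) (trans (≋⇒%≡ ∣-refl a≋b) (m<n⇒m%n≡m b<n))

  %≋ : .{{_ : NonZero n}} → ∀ a → a % n ≋ a
  %≋ a = a / n , 0 , trans (sym (m≡m%n+[m/n]*n a n)) (sym (+-identityʳ a))

module Discharging {n : ℕ} where

  share : (Fin n → Fin n → ℕ) → Edge n → Fin n → ℕ
  share c (u , v) x = 𝟙[ x ≟ u ] * c u v + 𝟙[ x ≟ v ] * c v u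

  load : (Fin n → Fin n → ℕ) → List (Edge n) → Fin n → ℕ
  load c I x = sum (map (λ e → share c e x) I)

  ∑-share : ∀ c (e : Edge n) → let (u , v) = e in ∑[ x < n ] share c e x ≡ c u v + c v u
  ∑-share c (u , v) = trans (∑-distrib-+ (λ x → 𝟙[ x ≟ u ] * c u v) (λ x → 𝟙[ x ≟ v ] * c v u))
                            (cong₂ _+_ (∑-𝟙-≟ u (c u v)) (∑-𝟙-≟ v (c v u)))

  2*length≤∑-load : ∀ c → (∀ u v → 2 ≤ c u v + c v u) → ∀ I → 2 * length I ≤ ∑[ x < n ] load c I x
  2*length≤∑-load c c-split [] = z≤n
  2*length≤∑-load c c-split (e@(u , v) ∷ I) = begin
    2 * suc (length I)                                 ≡⟨ *-suc 2 (length I) ⟩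
    2 + 2 * length I                                   ≤⟨ +-mono-≤ (c-split u v) (2*length≤∑-load c c-split I) ⟩
    c u v + c v u + ∑[ x < n ] load c I x              ≡⟨ cong (_+ _) (∑-share c e) ⟨
    ∑[ x < n ] share c e x + ∑[ x < n ] load c I x     ≡⟨ ∑-distrib-+ (share c e) (load c I) ⟨
    ∑[ x < n ] load c (e ∷ I) x                        ∎
    where open ≤-Reasoning

  load-∉V : ∀ c I {x} → x ∉ₛ V I → load c I x ≡ 0
  load-∉V c [] x∉ = refl
  load-∉V c ((u , v) ∷ I) {x} x∉ =
    cong₂ _+_ (cong₂ _+_ (cong (_* c u v) (𝟙-no (x ≟ u) x≢u)) (cong (_* c v u) (𝟙-no (x ≟ v) x≢v)))
              (load-∉V c I (x∉ ∘ x∈p∪q⁺ ∘ inj₂))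
    where
    x≢u : x ≢ u
    x≢u refl = x∉ (x∈p∪q⁺ (inj₁ (x∈p∪q⁺ (inj₁ (x∈⁅x⁆ x)))))
    x≢v : x ≢ v
    x≢v refl = x∉ (x∈p∪q⁺ (inj₁ (x∈p∪q⁺ (inj₂ (x∈⁅x⁆ x)))))

  discharging : ∀ c → (∀ u v → 2 ≤ c u v + c v u) → ∀ I {a} → (∀ x → load c I x ≤ a) →
    2 * length I ≤ a * ∣ V I ∣
  discharging c c-split I load≤a =
    ≤-trans (2*length≤∑-load c c-split I) (∑≤*∣∣ (V I) (load c I) _ (λ x → load-∉V c I) load≤a)

  Joins : Edge n → Fin n → Fin n → Set
  Joins (u , v) x y = (u ≡ x × v ≡ y) ⊎ (u ≡ y × v ≡ x)

  share-Joins : ∀ c {u v} x → u ≢ v →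
    share c (u , v) x ≡ 0 ⊎ ∃[ y ] (Joins (u , v) x y × y ≢ x × share c (u , v) x ≡ c x y)
  share-Joins c {u} {v} x u≢v with x ≟ u | x ≟ v
  ... | yes refl | yes refl = contradiction refl u≢v
  ... | yes refl | no x≢v = inj₂ (v , inj₁ (refl , refl) , x≢v ∘ sym , trans (+-identityʳ _) (+-identityʳ _))
  ... | no _ | yes refl = inj₂ (u , inj₂ (refl , refl) , u≢v , +-identityʳ _)
  ... | no _ | no _ = inj₁ refl

  Joins-unique : ∀ {u v u′ v′ x y} → toℕ u < toℕ v → toℕ u′ < toℕ v′ →
    Joins (u , v) x y → Joins (u′ , v′) x y → (u , v) ≡ (u′ , v′)
  Joins-unique _ _ (inj₁ (refl , refl)) (inj₁ (refl , refl)) = refl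
  Joins-unique u<v u′<v′ (inj₁ (refl , refl)) (inj₂ (refl , refl)) = contradiction u<v (<-asym u′<v′)
  Joins-unique u<v u′<v′ (inj₂ (refl , refl)) (inj₁ (refl , refl)) = contradiction u<v (<-asym u′<v′)
  Joins-unique _ _ (inj₂ (refl , refl)) (inj₂ (refl , refl)) = refl

  Adj-Joins : ∀ {r u v x y} → Joins (u , v) x y → Adj r n u v → Adj r n x y
  Adj-Joins (inj₁ (refl , refl)) adj = adj
  Adj-Joins (inj₂ (refl , refl)) (i , i<n , cu , cv) = i , i<n , cv , cu

module Kr2n (m′ k′ : ℕ) where

  m n r window : ℕ
  m = suc (suc m′)
  n = m + k′ * m
  r = 2 + m
  window = m + r

  open Congruence n
  open Discharging {n}
  module ≋-Reasoning = Relation.Binary.Reasoning.Setoid ≋-setoid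

  m∣n : m ∣ n
  m∣n = divides (suc k′) refl

  offset blockStart windowStart : Fin n → ℕ
  offset x = toℕ x % m
  blockStart x = toℕ x / m * m
  windowStart x = blockStart x + k′ * m    -- ≡ blockStart x - m (mod n), without truncated subtraction

  Interior : Fin n → Set
  Interior x = 2 ≤ offset x

  Slot : Fin n → ℕ → Fin n → Set
  Slot x e y = toℕ y ≋ windowStart x + e

  -- y is one of the two shared vertices closing the clique of the interior vertex x
  Claims : Fin n → Fin n → Set
  Claims x y = Interior x × offset y < 2 × Slot x (m + m + offset y) y

  toℕ≡blockStart+offset : ∀ x → toℕ x ≡ blockStart x + offset x
  toℕ≡blockStart+offset x = trans (m≡m%n+[m/n]*n (toℕ x) m) (+-comm (offset x) _)

  windowStart+m≋blockStart : ∀ x → windowStart x + m ≋ blockStart x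
  windowStart+m≋blockStart x = begin
    blockStart x + k′ * m + m    ≡⟨ +-assoc (blockStart x) _ m ⟩
    blockStart x + (k′ * m + m)  ≡⟨ cong (blockStart x +_) (+-comm (k′ * m) m) ⟩
    blockStart x + n             ≈⟨ +n≋ (blockStart x) ⟩
    blockStart x                 ∎
    where open ≋-Reasoning

  slot? : ∀ x e y → Dec (Slot x e y)
  slot? x e y = map′ (λ y≡ → ≋-trans (≡⇒≋ y≡) (%≋ w))
                     (λ y≋ → ≋⇒≡ (toℕ<n y) (m%n<n w n) (≋-trans y≋ (≋-sym (%≋ w))))
                     (toℕ y ℕ.≟ w % n)
    where
    w = windowStart x + e

  claims? : ∀ x y → Dec (Claims x y)
  claims? x y = (2 ≤? offset x) ×-dec (offset y <? 2) ×-dec slot? x (m + m + offset y) y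

  Slot-functional : ∀ {x e y y′} → Slot x e y → Slot x e y′ → y ≡ y′
  Slot-functional y≋ y′≋ = toℕ-injective (≋⇒≡ (toℕ<n _) (toℕ<n _) (≋-trans y≋ (≋-sym y′≋)))

  offset-Slot : ∀ {x e y} → Slot x e y → offset y ≡ e % m
  offset-Slot {x} {e} {y} y≋ = begin
    toℕ y % m                           ≡⟨ ≋⇒%≡ m∣n y≋ ⟩
    (windowStart x + e) % m             ≡⟨ cong (_% m) (rearrange (toℕ x / m) k′ m e) ⟩
    (e + (toℕ x / m + k′) * m) % m      ≡⟨ [m+kn]%n≡m%n e (toℕ x / m + k′) m ⟩
    e % m                               ∎
    where
    open ≡-Reasoning
    rearrange : ∀ q k m e → q * m + k * m + e ≡ e + (q + k) * m
    rearrange = solve-∀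

  toℕ≋windowStart+m+offset : ∀ x → toℕ x ≋ windowStart x + m + offset x
  toℕ≋windowStart+m+offset x = begin
    toℕ x                         ≡⟨ toℕ≡blockStart+offset x ⟩
    blockStart x + offset x       ≈⟨ ≋-+ʳ (offset x) (windowStart+m≋blockStart x) ⟨
    windowStart x + m + offset x  ∎
    where open ≋-Reasoning

  Slot-self : ∀ x → Slot x (m + offset x) x
  Slot-self x = ≋-trans (toℕ≋windowStart+m+offset x) (≡⇒≋ (+-assoc (windowStart x) m (offset x)))

  offset-in-clique : ∀ {j p} → j < r → j % m ≡ p → j ≡ p ⊎ (j ≡ m + p × p < 2)
  offset-in-clique {j} {p} j<r j%m≡p with j <? m
  ... | yes j<m = inj₁ (trans (sym (m<n⇒m%n≡m j<m)) j%m≡p)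
  ... | no j≮m = inj₂ (trans (sym m+[j∸m]≡j) (cong (m +_) j∸m≡p) , subst (_< 2) j∸m≡p j∸m<2)
    where
    m+[j∸m]≡j : m + (j ∸ m) ≡ j
    m+[j∸m]≡j = m+[n∸m]≡n (≮⇒≥ j≮m)
    j∸m<2 : j ∸ m < 2
    j∸m<2 = +-cancelˡ-< m (j ∸ m) 2 (subst₂ _<_ (sym m+[j∸m]≡j) (+-comm 2 m) j<r)
    j∸m≡p : j ∸ m ≡ p
    j∸m≡p = trans (sym (m<n⇒m%n≡m (<-≤-trans j∸m<2 (s≤s (s≤s z≤n)))))
                  (trans (m≤n⇒[n∸m]%m≡n%m (≮⇒≥ j≮m)) j%m≡p)

  InClique⇒≋ : ∀ {i x} → InClique r n i x → ∃[ j ] (j < r × i * m + j ≋ toℕ x)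
  InClique⇒≋ (j , j<r , t , eq) = j , j<r , 0 , t , trans (+-identityʳ _) eq

  clique-position : ∀ {i x} → InClique r n i x →
    i * m ≋ windowStart x + m ⊎ (offset x < 2 × i * m ≋ windowStart x + 0)
  clique-position {i} {x} cx with j , j<r , ij≋x ← InClique⇒≋ {i} cx
                             with offset-in-clique j<r j%m≡offset
    where
    j%m≡offset : j % m ≡ offset x
    j%m≡offset = trans (sym ([m+kn]%n≡m%n j i m)) (trans (cong (_% m) (+-comm j (i * m))) (≋⇒%≡ m∣n ij≋x))
  ... | inj₁ refl = inj₁ (≋-cancelʳ (offset x) (≋-trans ij≋x (toℕ≋windowStart+m+offset x)))
  ... | inj₂ (refl , offset<2) = inj₂ (offset<2 , (begin
    i * m                         ≈⟨ ≋-cancelʳ m (≋-cancelʳ (offset x) (begin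
      i * m + m + offset x          ≡⟨ +-assoc (i * m) m (offset x) ⟩
      i * m + (m + offset x)        ≈⟨ ij≋x ⟩
      toℕ x                         ≈⟨ toℕ≋windowStart+m+offset x ⟩
      windowStart x + m + offset x  ∎)) ⟩
    windowStart x                 ≡⟨ +-identityʳ (windowStart x) ⟨
    windowStart x + 0             ∎))
    where open ≋-Reasoning

  Slot-InClique : ∀ {i x y d} → i * m ≋ windowStart x + d → InClique r n i y →
    ∃[ j ] (j < r × Slot x (d + j) y)
  Slot-InClique {i} {x} {y} {d} im≋ cy with j , j<r , ij≋y ← InClique⇒≋ {i} cy = j , j<r , (begin
    toℕ y                  ≈⟨ ij≋y ⟨
    i * m + j              ≈⟨ ≋-+ʳ j im≋ ⟩
    windowStart x + d + j  ≡⟨ +-assoc (windowStart x) d j ⟩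
    windowStart x + (d + j) ∎)
    where open ≋-Reasoning

  Claims-back : ∀ {x j y} → offset x < 2 → Slot x j y → 2 ≤ j → j < m → Claims y x
  Claims-back {x} {j} {y} offset<2 y≋ 2≤j j<m = subst (2 ≤_) (sym offset≡j) 2≤j , offset<2 , x≋
    where
    open ≋-Reasoning
    offset≡j : offset y ≡ j
    offset≡j = trans (offset-Slot {x} {j} y≋) (m<n⇒m%n≡m j<m)
    blockStart≋ : blockStart y ≋ windowStart x
    blockStart≋ = ≋-cancelʳ j (begin
      blockStart y + j       ≡⟨ cong (blockStart y +_) offset≡j ⟨
      blockStart y + offset y ≡⟨ toℕ≡blockStart+offset y ⟨
      toℕ y                  ≈⟨ y≋ ⟩
      windowStart x + j      ∎)
    x≋ : Slot y (m + m + offset x) x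
    x≋ = begin
      toℕ x                             ≈⟨ toℕ≋windowStart+m+offset x ⟩
      windowStart x + m + offset x      ≈⟨ ≋-+ʳ (offset x) (≋-+ʳ m blockStart≋) ⟨
      blockStart y + m + offset x       ≈⟨ ≋-+ʳ (offset x) (≋-+ʳ m (windowStart+m≋blockStart y)) ⟨
      windowStart y + m + m + offset x  ≡⟨ cong (_+ offset x) (+-assoc (windowStart y) m m) ⟩
      windowStart y + (m + m) + offset x ≡⟨ +-assoc (windowStart y) (m + m) (offset x) ⟩
      windowStart y + (m + m + offset x) ∎

  opaque
    charge : Fin n → Fin n → ℕ
    charge x y with claims? x y | claims? y x
    ... | yes _ | _ = 2
    ... | no _ | yes _ = 0
    ... | no _ | no _ = 1

    charge-split : ∀ x y → 2 ≤ charge x y + charge y x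
    charge-split x y with claims? x y | claims? y x
    ... | yes _ | _ = m≤m+n 2 _
    ... | no _ | yes _ = ≤-refl
    ... | no _ | no _ = ≤-refl

    charge-claims : ∀ {x y} → Claims x y → charge x y ≡ 2
    charge-claims {x} {y} c with claims? x y
    ... | yes _ = refl
    ... | no ¬c = contradiction c ¬c

    charge-≤1 : ∀ {x y} → ¬ Claims x y → charge x y ≤ 1
    charge-≤1 {x} {y} ¬c with claims? x y | claims? y x
    ... | yes c | _ = contradiction c ¬c
    ... | no _ | yes _ = z≤n
    ... | no _ | no _ = ≤-refl

    charge-claimed : ∀ {x y} → ¬ Claims x y → Claims y x → charge x y ≡ 0
    charge-claimed {x} {y} ¬c c′ with claims? x y | claims? y x
    ... | yes c | _ = contradiction c ¬c
    ... | no _ | yes _ = refl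
    ... | no _ | no ¬c′ = contradiction c′ ¬c′

  -- Slots below m of an interior vertex lie in the previous block, and slots 2 .. m - 1 of a
  -- shared vertex hold interior vertices, which claim their edge to it.
  interiorWeight sharedWeight : ℕ → ℕ
  interiorWeight e = 𝟙[ m ≤? e ] + 𝟙[ m + m ≤? e ]
  sharedWeight e = 𝟙[ m ≤? e ] + 𝟙[ e <? 2 ]

  slotWeight : Fin n → ℕ → ℕ
  slotWeight x with 2 ≤? offset x
  ... | yes _ = interiorWeight
  ... | no _ = sharedWeight

  window∸m≡r : window ∸ m ≡ r
  window∸m≡r = m+n∸m≡n m r

  window∸[m+m]≡2 : window ∸ (m + m) ≡ 2
  window∸[m+m]≡2 = trans (cong (_∸ (m + m)) window≡) (m+n∸m≡n (m + m) 2)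
    where
    window≡ : window ≡ m + m + 2
    window≡ = trans (cong (m +_) (+-comm 2 m)) (sym (+-assoc m m 2))

  slotWeight-interior : ∀ {x} → Interior x → ∀ e → slotWeight x e ≡ interiorWeight e
  slotWeight-interior {x} interior e with 2 ≤? offset x
  ... | yes _ = refl
  ... | no ¬interior = contradiction interior ¬interior

  slotWeight-shared : ∀ {x} → ¬ Interior x → ∀ e → slotWeight x e ≡ sharedWeight e
  slotWeight-shared {x} ¬interior e with 2 ≤? offset x
  ... | yes interior = contradiction interior ¬interior
  ... | no _ = refl

  ∑-slotWeight : ∀ x → sum (map (slotWeight x) (downFrom window)) ≡ suc (r + 1)
  ∑-slotWeight x with 2 ≤? offset x
  ... | yes _ = begin
    sum (map interiorWeight slots)       ≡⟨ sum-map-+ (λ e → 𝟙[ m ≤? e ]) (λ e → 𝟙[ m + m ≤? e ]) slots ⟩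
    _                                    ≡⟨ cong₂ _+_ (sum-𝟙-≤ m window) (sum-𝟙-≤ (m + m) window) ⟩
    (window ∸ m) + (window ∸ (m + m))    ≡⟨ cong₂ _+_ window∸m≡r window∸[m+m]≡2 ⟩
    r + 2                                ≡⟨ +-suc r 1 ⟩
    suc (r + 1)                          ∎
    where
    open ≡-Reasoning
    slots = downFrom window
  ... | no _ = begin
    sum (map sharedWeight slots)         ≡⟨ sum-map-+ (λ e → 𝟙[ m ≤? e ]) (λ e → 𝟙[ e <? 2 ]) slots ⟩
    _                                    ≡⟨ cong₂ _+_ (sum-𝟙-≤ m window) (sum-𝟙-< 2 window) ⟩
    (window ∸ m) + 2                     ≡⟨ cong (_+ 2) window∸m≡r ⟩
    r + 2                                ≡⟨ +-suc r 1 ⟩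
    suc (r + 1)                          ∎
    where
    open ≡-Reasoning
    slots = downFrom window

  offset<m : ∀ x → offset x < m
  offset<m x = m%n<n (toℕ x) m

  self<window : ∀ x → m + offset x < window
  self<window x = +-monoʳ-< m (<-≤-trans (offset<m x) (m≤n+m m 2))

  slotWeight-self : ∀ x → slotWeight x (m + offset x) ≡ 1
  slotWeight-self x with 2 ≤? offset x
  ... | yes _ = cong₂ _+_ (𝟙-yes (m ≤? m + o) (m≤m+n m o))
                          (𝟙-no (m + m ≤? m + o) (<⇒≱ (offset<m x) ∘ +-cancelˡ-≤ m m o))
    where o = offset x
  ... | no _ = cong₂ _+_ (𝟙-yes (m ≤? m + o) (m≤m+n m o))
                         (𝟙-no (m + o <? 2) (λ m+o<2 → <⇒≱ m+o<2 (≤-trans (s≤s (s≤s z≤n)) (m≤m+n m o))))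
    where o = offset x

  interiorWeight-claimed : ∀ b → interiorWeight (m + m + b) ≡ 2
  interiorWeight-claimed b = cong₂ _+_ (𝟙-yes (m ≤? m + m + b) (≤-trans (m≤m+n m m) (m≤m+n (m + m) b)))
                                       (𝟙-yes (m + m ≤? m + m + b) (m≤m+n (m + m) b))

  claimed<window : ∀ {b} → b < 2 → m + m + b < window
  claimed<window {b} b<2 = subst (_< window) (sym (+-assoc m m b))
    (+-monoʳ-< m (subst (m + b <_) (+-comm m 2) (+-monoʳ-< m b<2)))

  ChargedSlot : (ℕ → ℕ) → Fin n → Fin n → Set
  ChargedSlot weight x y = ∃[ e ] (e < window × Slot x e y × charge x y ≤ weight e)

  interior-slot : ∀ {x y} → Interior x → Adj r n x y → ChargedSlot interiorWeight x y
  interior-slot {x} {y} interior (i , _ , cx , cy) = by-claim (claims? x y)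
    where
    by-claim : Dec (Claims x y) → ChargedSlot interiorWeight x y
    by-claim (yes c@(_ , offset<2 , y≋)) = m + m + offset y , claimed<window offset<2 , y≋ ,
      ≤-reflexive (trans (charge-claims c) (sym (interiorWeight-claimed (offset y))))
    by-claim (no ¬c) with clique-position {i} cx
    ... | inj₂ (offset<2 , _) = contradiction interior (<⇒≱ offset<2)
    ... | inj₁ opening with j , j<r , y≋ ← Slot-InClique {i} {x} opening cy =
      m + j , +-monoʳ-< m j<r , y≋ , ≤-trans (charge-≤1 ¬c) (1≤𝟙+ (m ≤? m + j) (m≤m+n m j) _)

  shared-slot : ∀ {x y} → ¬ Interior x → Adj r n x y → ChargedSlot sharedWeight x y
  shared-slot {x} {y} ¬interior (i , _ , cx , cy) with clique-position {i} cx
  ... | inj₁ opening with j , j<r , y≋ ← Slot-InClique {i} {x} opening cy =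
    m + j , +-monoʳ-< m j<r , y≋ ,
    ≤-trans (charge-≤1 (¬interior ∘ proj₁)) (1≤𝟙+ (m ≤? m + j) (m≤m+n m j) _)
  ... | inj₂ (offset<2 , closing) with j , j<r , y≋ ← Slot-InClique {i} {x} closing cy =
    j , <-≤-trans j<r (m≤n+m r m) , y≋ , by-claim (claims? y x)
    where
    by-claim : Dec (Claims y x) → charge x y ≤ sharedWeight j
    by-claim (yes c) = subst (_≤ sharedWeight j) (sym (charge-claimed (¬interior ∘ proj₁) c)) z≤n
    by-claim (no ¬c) = ≤-trans (charge-≤1 (¬interior ∘ proj₁)) (1≤sharedWeight (m ≤? j))
      where
      1≤sharedWeight : Dec (m ≤ j) → 1 ≤ sharedWeight j
      1≤sharedWeight (yes m≤j) = 1≤𝟙+ (m ≤? j) m≤j _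
      1≤sharedWeight (no m≰j) = ≤-trans (≤-reflexive (sym (𝟙-yes (j <? 2) j<2))) (m≤n+m _ _)
        where
        j<2 : j < 2
        j<2 = ≰⇒> (λ 2≤j → ¬c (Claims-back offset<2 y≋ 2≤j (≰⇒> m≰j)))

  neighbour-slot : ∀ {x y} → Adj r n x y → ChargedSlot (slotWeight x) x y
  neighbour-slot {x} {y} adj = by-offset (2 ≤? offset x)
    where
    by-offset : Dec (Interior x) → ChargedSlot (slotWeight x) x y
    by-offset (yes interior) with e , e<window , y≋ , charge≤ ← interior-slot interior adj =
      e , e<window , y≋ , subst (charge x y ≤_) (sym (slotWeight-interior {x} interior e)) charge≤
    by-offset (no ¬interior) with e , e<window , y≋ , charge≤ ← shared-slot ¬interior adj =
      e , e<window , y≋ , subst (charge x y ≤_) (sym (slotWeight-shared {x} ¬interior e)) charge≤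

  EdgeSlot : Fin n → Edge n → ℕ → Set
  EdgeSlot x a e = ∃[ y ] (Joins a x y × Slot x e y)

  share-slot : ∀ {a} → IsEdgeOfK r n a → ∀ x → share charge a x ≡ 0 ⊎
    ∃[ e ] (EdgeSlot x a e × share charge a x ≤ slotWeight x e × e ∈ downFrom window × e ≢ m + offset x)
  share-slot (u<v , adj) x with share-Joins charge x (<⇒≢ u<v ∘ cong toℕ)
  ... | inj₁ share≡0 = inj₁ share≡0
  ... | inj₂ (y , joins , y≢x , share≡) with e , e<window , y≋ , charge≤ ← neighbour-slot (Adj-Joins joins adj) =
    inj₂ (e , (y , joins , y≋) , subst (_≤ slotWeight x e) (sym share≡) charge≤ , ∈-downFrom⁺ e<window ,
          λ { refl → y≢x (Slot-functional {x} {e} y≋ (Slot-self x)) })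

  load-charge-≤ : ∀ {I} → Unique I → All (IsEdgeOfK r n) I → ∀ x → load charge I x ≤ r + 1
  load-charge-≤ {I} unique edges x =
    s≤s⁻¹ (subst₂ _≤_ (cong (_+ load charge I x) (slotWeight-self x)) (∑-slotWeight x)
      (sum-map-≤-injection-avoiding (λ a → share charge a x) (slotWeight x) (EdgeSlot x)
        (∈-downFrom⁺ (self<window x)) unique injective (λ a∈I → share-slot (All.lookup edges a∈I) x)))
    where
    injective : ∀ {a a′ e} → a ∈ I → a′ ∈ I → EdgeSlot x a e → EdgeSlot x a′ e → a ≡ a′
    injective {e = e} a∈I a′∈I (y , joins , y≋) (y′ , joins′ , y′≋)
      with refl ← Slot-functional {x} {e} y≋ y′≋ =
      Joins-unique (proj₁ (All.lookup edges a∈I)) (proj₁ (All.lookup edges a′∈I)) joins joins′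

lemma3p13 : (r n : ℕ) → 4 ≤ r → (r ∸ 2) ∣ n →
    (I : List (Edge n)) → Unique I → All (IsEdgeOfK r n) I →
    2 * length I ≤ (r + 1) * ∣ V I ∣
lemma3p13 (suc (suc (suc (suc m′)))) _ (s≤s (s≤s (s≤s (s≤s _)))) (divides zero refl) [] _ _ = z≤n
lemma3p13 (suc (suc (suc (suc m′)))) _ (s≤s (s≤s (s≤s (s≤s _)))) (divides zero refl) ((() , _) ∷ _) _ _
lemma3p13 (suc (suc (suc (suc m′)))) _ (s≤s (s≤s (s≤s (s≤s _)))) (divides (suc k′) refl) I unique edges =
  discharging charge charge-split I (load-charge-≤ unique edges)
  where
  open Kr2n m′ k′
  open Discharging
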